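{- Let $p$ be a prime and $k,l,r\ge 0$ integers, and let $a_{21},a_{31},a_{32}\in\mathbb{Z}_p$. Consider the matrix \[ M=\begin{bmatrix} p^k & 0 & 0 & 0\\ a_{21} & p^l & 0 & 0\\ a_{31} & a_{32} & p^r & 0\\ 0&0&0&1 \end{bmatrix}. \] Then $M\in\mathcal{M}_4(p)$ if and only if \[ 0\le l\le 2r,\qquad 0\le k\le l+r,\qquad k+l-r\le v(2p^l a_{32}-p^r a_{21}), \] where $v$ is the $p$-adic valuation (with $v(0)=\infty$).
   Context: Identify $R_p=\mathbb{Z}_p[t]/(t^4)$ with $\mathbb{Z}_p^4$ by letting the row vector $(c_1,c_2,c_3,c_4)$ represent $c_1t^3+c_2t^2+c_3t+c_4$; the product $v\cdot w$ of two row vectors is the row vector representing the product of the corresponding elements of $R_p$. $\mathcal{M}_4(p)$ is the set of $4\times4$ lower triangular matrices with entries in $\mathbb{Z}_p$ whose rows $v_1,\dots,v_4$ satisfy: for all $1\le i,j\le 4$ there exist $c_{ij}^1,\dots,c_{ij}^4\in\mathbb{Z}_p$ with $v_i\cdot v_j=\sum_{k=1}^4 c_{ij}^k v_k$. -}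

module Defs where

open import Data.Nat as ℕ using (ℕ; suc; _^_)
open import Data.Integer as ℤ using (ℤ; +_; _-_)
open import Data.Fin using (Fin; zero; suc; toℕ)
open import Data.Product using (∃; Σ; _×_; _,_)
open import Relation.Binary.PropositionalEquality
open import Data.Integer.Solver using (module +-*-Solver)
open +-*-Solver

_∣ℤ_ : ℤ → ℤ → Set
d ∣ℤ z = ∃ λ q → z ≡ q ℤ.* d

-- The p-adic integers ℤ_p as the inverse limit of ℤ/p^n:
-- coherent sequences of integers x₀, x₁, … with x_{n+1} ≡ x_n (mod p^n),
-- taken up to the equivalence x ≈ y iff x_n ≡ y_n (mod p^n) for all n.

vec4 : {A : Set} → A → A → A → A → Fin 4 → A
vec4 a b c d zero = a
vec4 a b c d (suc zero) = b
vec4 a b c d (suc (suc zero)) = c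
vec4 a b c d (suc (suc (suc zero))) = d

pw : ℕ → ℕ → ℤ
pw p n = + (p ^ n)

record ℤp (p : ℕ) : Set where
  constructor mkℤp
  field
    seq : ℕ → ℤ
    coh : ∀ n → pw p n ∣ℤ (seq (suc n) - seq n)
open ℤp public

module _ {p : ℕ} where

  infix 4 _≈_
  _≈_ : ℤp p → ℤp p → Set
  x ≈ y = ∀ n → pw p n ∣ℤ (seq x n - seq y n)

  ι : ℤ → ℤp p
  ι z = mkℤp (λ _ → z) (λ n → ℤ.0ℤ , lem n z)
    where
    lem : ∀ n z → z - z ≡ ℤ.0ℤ ℤ.* pw p n
    lem n z = solve 2 (λ z d → z :- z := con ℤ.0ℤ :* d) refl z (pw p n)

  0p 1p : ℤp p
  0p = ι ℤ.0ℤ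
  1p = ι ℤ.1ℤ

  infixl 6 _+p_
  infixl 7 _*p_

  _+p_ : ℤp p → ℤp p → ℤp p
  x +p y = mkℤp (λ n → seq x n ℤ.+ seq y n) c
    where
    c : ∀ n → pw p n ∣ℤ ((seq x (suc n) ℤ.+ seq y (suc n)) - (seq x n ℤ.+ seq y n))
    c n with coh x n | coh y n
    ... | q₁ , e₁ | q₂ , e₂ = q₁ ℤ.+ q₂ , (begin
          (x' ℤ.+ y') - (x₀ ℤ.+ y₀)
            ≡⟨ solve 4 (λ a b c d → (a :+ b) :- (c :+ d) := (a :- c) :+ (b :- d)) refl x' y' x₀ y₀ ⟩
          (x' - x₀) ℤ.+ (y' - y₀)
            ≡⟨ cong₂ ℤ._+_ e₁ e₂ ⟩
          q₁ ℤ.* d ℤ.+ q₂ ℤ.* d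
            ≡⟨ solve 3 (λ a b d → a :* d :+ b :* d := (a :+ b) :* d) refl q₁ q₂ d ⟩
          (q₁ ℤ.+ q₂) ℤ.* d ∎)
      where
      open ≡-Reasoning
      x' = seq x (suc n); y' = seq y (suc n); x₀ = seq x n; y₀ = seq y n; d = pw p n

  _*p_ : ℤp p → ℤp p → ℤp p
  x *p y = mkℤp (λ n → seq x n ℤ.* seq y n) c
    where
    c : ∀ n → pw p n ∣ℤ ((seq x (suc n) ℤ.* seq y (suc n)) - (seq x n ℤ.* seq y n))
    c n with coh x n | coh y n
    ... | q₁ , e₁ | q₂ , e₂ = x' ℤ.* q₂ ℤ.+ q₁ ℤ.* y₀ , (begin
          x' ℤ.* y' - x₀ ℤ.* y₀
            ≡⟨ solve 4 (λ a b c e → a :* b :- c :* e := a :* (b :- e) :+ (a :- c) :* e) refl x' y' x₀ y₀ ⟩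
          x' ℤ.* (y' - y₀) ℤ.+ (x' - x₀) ℤ.* y₀
            ≡⟨ cong₂ (λ u v → x' ℤ.* u ℤ.+ v ℤ.* y₀) e₂ e₁ ⟩
          x' ℤ.* (q₂ ℤ.* d) ℤ.+ (q₁ ℤ.* d) ℤ.* y₀
            ≡⟨ solve 5 (λ a b c e f → a :* (b :* f) :+ (c :* f) :* e := (a :* b :+ c :* e) :* f) refl x' q₂ q₁ y₀ d ⟩
          (x' ℤ.* q₂ ℤ.+ q₁ ℤ.* y₀) ℤ.* d ∎)
      where
      open ≡-Reasoning
      x' = seq x (suc n); y' = seq y (suc n); x₀ = seq x n; y₀ = seq y n; d = pw p n

  infixl 6 _-p_
  _-p_ : ℤp p → ℤp p → ℤp p
  x -p y = x +p ι (ℤ.- ℤ.1ℤ) *p y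

  p^ : ℕ → ℤp p
  p^ n = ι (pw p n)

  -- v(x) ≥ n  (p-adic valuation, v(0) = ∞), i.e. x ∈ p^n ℤ_p
  v≥ : ℕ → ℤp p → Set
  v≥ n x = ∃ λ (y : ℤp p) → x ≈ p^ n *p y

  -- R_p = ℤ_p[t]/(t^4) on row vectors (c₁,c₂,c₃,c₄) ↦ c₁t³+c₂t²+c₃t+c₄
  -- (index zero = c₁, …, index 3 = c₄)

  Row : Set
  Row = Fin 4 → ℤp p

  mkRow : ℤp p → ℤp p → ℤp p → ℤp p → Row
  mkRow = vec4

  _·_ : Row → Row → Row
  v · w = mkRow
    (a1 *p b4 +p a2 *p b3 +p a3 *p b2 +p a4 *p b1)
    (a2 *p b4 +p a3 *p b3 +p a4 *p b2)
    (a3 *p b4 +p a4 *p b3)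
    (a4 *p b4)
    where
    a1 = v zero; a2 = v (suc zero); a3 = v (suc (suc zero)); a4 = v (suc (suc (suc zero)))
    b1 = w zero; b2 = w (suc zero); b3 = w (suc (suc zero)); b4 = w (suc (suc (suc zero)))

  Mat : Set
  Mat = Fin 4 → Row      -- M i = i-th row

  sum4 : (Fin 4 → ℤp p) → ℤp p
  sum4 f = f zero +p f (suc zero) +p f (suc (suc zero)) +p f (suc (suc (suc zero)))

  LowerTriangular : Mat → Set
  LowerTriangular M = ∀ i j → toℕ i ℕ.< toℕ j → M i j ≈ 0p

  InM4 : Mat → Set
  InM4 M = LowerTriangular M ×
    (∀ i j → Σ (Fin 4 → ℤp p) λ c → ∀ m → (M i · M j) m ≈ sum4 (λ k → c k *p M k m))

-- Write v₁ = pᵏt³, v₂ = a₂₁t³ + pˡt², v₃ = a₃₁t³ + a₃₂t² + pʳt and v₄ = 1 for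
-- the rows. Products with v₄ lie in the span trivially, v₁ kills every row
-- without constant term and v₂² = 0, so only v₂v₃ = p^(l+r)t³ and
-- v₃² = 2pʳa₃₂t³ + p^(2r)t² matter. Comparing coefficients from the t-column
-- upwards, v₂v₃ = Σ cᵢvᵢ forces c₃ = c₂ = 0 and p^(l+r) = pᵏc₁, so k ≤ l + r;
-- v₃² = Σ dᵢvᵢ forces d₃ = 0 and p^(2r) = pˡd₂, so l ≤ 2r and d₂ = p^(2r-l),
-- and then Z = 2pʳa₃₂ - p^(2r-l)a₂₁ = pᵏd₁. Conversely these choices of
-- coefficients work. Finally pˡZ = pʳX for X = 2pˡa₃₂ - pʳa₂₁, and ℤ_p has no
-- p-torsion, so v(Z) ≥ k iff v(X) ≥ k + l - r; when k + l < r both hold.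

module Submission where

open import Defs
open import Data.Nat as ℕ using (ℕ; zero; suc; _+_; _*_; _∸_; _≤_; _<_; NonZero)
import Data.Nat.Properties as ℕP
open import Data.Nat.Divisibility using (divides; ∣⇒≤)
open import Data.Nat.Primality using (Prime; prime⇒nonTrivial)
open import Data.Integer as ℤ using (+_; _-_)
import Data.Integer.Properties as ℤP
open import Data.Integer.Solver using (module +-*-Solver)
open import Data.Fin as Fin using (Fin)
open import Data.Fin.Patterns using (0F; 1F; 2F; 3F)
open import Data.Product using (Σ; _×_; _,_; proj₁; proj₂)
open import Function.Bundles using (_⇔_; mk⇔; Equivalence)
open import Relation.Nullary using (yes; no)
open import Relation.Binary.Bundles using (Setoid)
open import Relation.Binary.PropositionalEquality as ≡ using (_≡_)
import Relation.Binary.Reasoning.Setoid as SetoidReasoning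

open +-*-Solver using (Polynomial; solve; _:+_; _:*_; _:-_; _:=_; con)

𝟎 𝟏 : ∀ {m} → Polynomial m
𝟎 = con ℤ.0ℤ
𝟏 = con ℤ.1ℤ

-- The shape of _-p_, which subtracts by multiplying with ι (-1).
infixl 7 _⊖_
_⊖_ : ∀ {m} → Polynomial m → Polynomial m → Polynomial m
x ⊖ y = x :+ con (ℤ.- ℤ.1ℤ) :* y

∣ℤ-+ : ∀ {d a b} → d ∣ℤ a → d ∣ℤ b → d ∣ℤ (a ℤ.+ b)
∣ℤ-+ {d} (q , a≡qd) (q′ , b≡q′d) =
  q ℤ.+ q′ , ≡.trans (≡.cong₂ ℤ._+_ a≡qd b≡q′d) (≡.sym (ℤP.*-distribʳ-+ d q q′))

∣ℤ-*ˡ : ∀ {d a} c → d ∣ℤ a → d ∣ℤ (c ℤ.* a)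
∣ℤ-*ˡ {d} c (q , a≡qd) = c ℤ.* q , ≡.trans (≡.cong (c ℤ.*_) a≡qd) (≡.sym (ℤP.*-assoc c q d))

pw-+ : ∀ p a b → pw p (a + b) ≡ pw p a ℤ.* pw p b
pw-+ p a b = ≡.trans (≡.cong +_ (ℕP.^-distribˡ-+-* p a b)) (ℤP.pos-* (p ℕ.^ a) (p ℕ.^ b))

module _ {p : ℕ} where

  -- ℤ_p as a setoid

  -- A record wrapper around _≈_: unlike the function _≈_ it is injective, so
  -- Agda can infer the compared elements from the type. Arguments that occur
  -- under _+p_ or _*p_ are still given explicitly below, since inferring them
  -- would make Agda unfold the large coherence proofs inside ℤp.
  infix 4 _≋_
  record _≋_ (x y : ℤp p) : Set where
    constructor ≈⇒≋
    field ≋⇒≈ : x ≈ y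
  open _≋_ public

  ≋-pointwise : {x y : ℤp p} → (∀ n → seq x n ≡ seq y n) → x ≋ y
  ≋-pointwise {x} {y} e = ≈⇒≋ λ n →
    ℤ.0ℤ , ≡.trans (≡.cong (seq x n -_) (≡.sym (e n)))
                   (≡.trans (ℤP.+-inverseʳ (seq x n)) (≡.sym (ℤP.*-zeroˡ (pw p n))))

  ≋-refl : {x : ℤp p} → x ≋ x
  ≋-refl = ≋-pointwise λ _ → ≡.refl

  ≋-sym : {x y : ℤp p} → x ≋ y → y ≋ x
  ≋-sym {x} {y} (≈⇒≋ x≈y) = ≈⇒≋ λ n →
    ≡.subst (pw p n ∣ℤ_) (solve 2 (λ a b → con (ℤ.- ℤ.1ℤ) :* (a :- b) := b :- a) ≡.refl (seq x n) (seq y n))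
      (∣ℤ-*ˡ (ℤ.- ℤ.1ℤ) (x≈y n))

  ≋-trans : {x y z : ℤp p} → x ≋ y → y ≋ z → x ≋ z
  ≋-trans {x} {y} {z} (≈⇒≋ x≈y) (≈⇒≋ y≈z) = ≈⇒≋ λ n →
    ≡.subst (pw p n ∣ℤ_) (solve 3 (λ a b c → (a :- b) :+ (b :- c) := a :- c) ≡.refl (seq x n) (seq y n) (seq z n))
      (∣ℤ-+ (x≈y n) (y≈z n))

  ≋-setoid : Setoid _ _
  ≋-setoid = record
    { Carrier = ℤp p ; _≈_ = _≋_
    ; isEquivalence = record { refl = ≋-refl ; sym = ≋-sym ; trans = ≋-trans } }

  +p-cong : {x x′ y y′ : ℤp p} → x ≋ x′ → y ≋ y′ → x +p y ≋ x′ +p y′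
  +p-cong {x} {x′} {y} {y′} (≈⇒≋ x≈x′) (≈⇒≋ y≈y′) = ≈⇒≋ λ n →
    ≡.subst (pw p n ∣ℤ_) (solve 4 (λ a a′ b b′ → (a :- a′) :+ (b :- b′) := (a :+ b) :- (a′ :+ b′)) ≡.refl
        (seq x n) (seq x′ n) (seq y n) (seq y′ n))
      (∣ℤ-+ (x≈x′ n) (y≈y′ n))

  *p-cong : {x x′ y y′ : ℤp p} → x ≋ x′ → y ≋ y′ → x *p y ≋ x′ *p y′
  *p-cong {x} {x′} {y} {y′} (≈⇒≋ x≈x′) (≈⇒≋ y≈y′) = ≈⇒≋ λ n →
    ≡.subst (pw p n ∣ℤ_) (solve 4 (λ a a′ b b′ → b :* (a :- a′) :+ a′ :* (b :- b′) := a :* b :- a′ :* b′) ≡.refl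
        (seq x n) (seq x′ n) (seq y n) (seq y′ n))
      (∣ℤ-+ (∣ℤ-*ˡ (seq y n) (x≈x′ n)) (∣ℤ-*ˡ (seq x′ n) (y≈y′ n)))

  +p-congˡ : ∀ a {y y′ : ℤp p} → y ≋ y′ → a +p y ≋ a +p y′
  +p-congˡ a y≋y′ = +p-cong (≋-refl {a}) y≋y′

  +p-congʳ : ∀ {x x′ : ℤp p} → x ≋ x′ → ∀ b → x +p b ≋ x′ +p b
  +p-congʳ x≋x′ b = +p-cong x≋x′ (≋-refl {b})

  *p-congˡ : ∀ a {y y′ : ℤp p} → y ≋ y′ → a *p y ≋ a *p y′
  *p-congˡ a y≋y′ = *p-cong (≋-refl {a}) y≋y′

  *p-congʳ : ∀ {x x′ : ℤp p} → x ≋ x′ → ∀ b → x *p b ≋ x′ *p b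
  *p-congʳ x≋x′ b = *p-cong x≋x′ (≋-refl {b})

  -p-cong : ∀ {x x′ y y′ : ℤp p} → x ≋ x′ → y ≋ y′ → x -p y ≋ x′ -p y′
  -p-cong x≋x′ y≋y′ = +p-cong x≋x′ (*p-congˡ (ι (ℤ.- ℤ.1ℤ)) y≋y′)

  -p-congˡ : ∀ a {y y′ : ℤp p} → y ≋ y′ → a -p y ≋ a -p y′
  -p-congˡ a {y} {y′} y≋y′ = -p-cong {a} {a} {y} {y′} ≋-refl y≋y′

  -p-congʳ : ∀ {x x′ : ℤp p} → x ≋ x′ → ∀ b → x -p b ≋ x′ -p b
  -p-congʳ {x} {x′} x≋x′ b = -p-cong {x} {x′} {b} {b} x≋x′ ≋-refl

  +p-*p-vanishes : ∀ x a (z : ℤp p) → z ≋ 0p → x +p a *p z ≋ x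
  +p-*p-vanishes x a z z≋0 = ≋-trans (+p-congˡ x (*p-congˡ a z≋0))
    (≋-pointwise λ n → solve 2 (λ u v → u :+ v :* 𝟎 := u) ≡.refl (seq x n) (seq a n))

  -- Powers of p

  p^-cong : ∀ {m n} → m ≡ n → p^ {p} m ≋ p^ n
  p^-cong m≡n = ≋-pointwise λ _ → ≡.cong (pw p) m≡n

  p^-+ : ∀ a b → p^ (a + b) ≋ p^ a *p p^ b
  p^-+ a b = ≋-pointwise λ _ → pw-+ p a b

  p^-split : ∀ {m n} → m ≤ n → p^ n ≋ p^ m *p p^ (n ∸ m)
  p^-split {m} {n} m≤n =
    ≋-trans (p^-cong (≡.sym (ℕP.m+[n∸m]≡n m≤n))) (p^-+ m (n ∸ m))

  p^-double : ∀ n → p^ (2 * n) ≋ p^ n *p p^ n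
  p^-double n = ≋-trans (p^-cong (≡.cong (n ℕ.+_) (ℕP.+-identityʳ n))) (p^-+ n n)

  p^-*p^ : ∀ a b (y : ℤp p) → p^ a *p (p^ b *p y) ≋ p^ (b + a) *p y
  p^-*p^ a b y = ≋-pointwise λ n → ≡.trans
    (solve 3 (λ u v w → u :* (v :* w) := (v :* u) :* w) ≡.refl (pw p a) (pw p b) (seq y n))
    (≡.cong (ℤ._* seq y n) (≡.sym (pw-+ p b a)))

  coh-iterated : (x : ℤp p) → ∀ m n → pw p n ∣ℤ (seq x (m + n) - seq x n)
  coh-iterated x zero n = ≋⇒≈ (≋-refl {x}) n
  coh-iterated x (suc m) n =
    ≡.subst (pw p n ∣ℤ_) (solve 3 (λ a b c → (a :- b) :+ (b :- c) := a :- c) ≡.refl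
        (seq x (suc m + n)) (seq x (m + n)) (seq x n))
      (∣ℤ-+ step (coh-iterated x m n))
    where
    step : pw p n ∣ℤ (seq x (suc (m + n)) - seq x (m + n))
    step with coh x (m + n)
    ... | q , e = q ℤ.* pw p m , ≡.trans e (≡.trans (≡.cong (q ℤ.*_) (pw-+ p m n))
                                                     (≡.sym (ℤP.*-assoc q (pw p m) (pw p n))))

  p^-cancelˡ : .{{NonZero p}} → ∀ l {x y : ℤp p} → p^ l *p x ≋ p^ l *p y → x ≋ y
  p^-cancelˡ l {x} {y} (≈⇒≋ h) = ≈⇒≋ λ n →
    ≡.subst (pw p n ∣ℤ_) (solve 4 (λ a b a′ b′ → con (ℤ.- ℤ.1ℤ) :* (a′ :- a) :+ (a′ :- b′) :+ (b′ :- b) := a :- b) ≡.refl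
        (seq x n) (seq y n) (seq x (l + n)) (seq y (l + n)))
      (∣ℤ-+ (∣ℤ-+ (∣ℤ-*ˡ (ℤ.- ℤ.1ℤ) (coh-iterated x l n)) (tail n)) (coh-iterated y l n))
    where
    tail : ∀ n → pw p n ∣ℤ (seq x (l + n) - seq y (l + n))
    tail n with h (l + n)
    ... | q , e = q , ℤP.*-cancelˡ-≡ (pw p l) _ _ {{ℕP.m^n≢0 p l}} (begin
      pw p l ℤ.* (x′ - y′)            ≡⟨ solve 3 (λ c a b → c :* (a :- b) := c :* a :- c :* b) ≡.refl (pw p l) x′ y′ ⟩
      pw p l ℤ.* x′ - pw p l ℤ.* y′   ≡⟨ e ⟩
      q ℤ.* pw p (l + n)              ≡⟨ ≡.cong (q ℤ.*_) (pw-+ p l n) ⟩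
      q ℤ.* (pw p l ℤ.* pw p n)       ≡⟨ solve 3 (λ a b c → a :* (b :* c) := b :* (a :* c)) ≡.refl q (pw p l) (pw p n) ⟩
      pw p l ℤ.* (q ℤ.* pw p n)       ∎)
      where
      open ≡.≡-Reasoning
      x′ = seq x (l + n)
      y′ = seq y (l + n)

  p^*x≋0⇒x≋0 : .{{NonZero p}} → ∀ n {x : ℤp p} → p^ n *p x ≋ 0p → x ≋ 0p
  p^*x≋0⇒x≋0 n {x} pⁿx≋0 = p^-cancelˡ n {x} {0p}
    (≋-trans pⁿx≋0 (≋-pointwise λ _ → ≡.sym (ℤP.*-zeroʳ (pw p n))))

  -- Divisibility by powers of p

  v≥-intro : ∀ {n} {x : ℤp p} y → x ≋ p^ n *p y → v≥ n x
  v≥-intro y (≈⇒≋ x≈pⁿy) = y , x≈pⁿy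

  v≥-elim : ∀ {n} {x : ℤp p} ((y , _) : v≥ n x) → x ≋ p^ n *p y
  v≥-elim (_ , x≈pⁿy) = ≈⇒≋ x≈pⁿy

  v≥-zero : (x : ℤp p) → v≥ 0 x
  v≥-zero x = v≥-intro {0} {x} x (≋-pointwise λ n → ≡.sym (ℤP.*-identityˡ (seq x n)))

  v≥-p^⇒≤ : 1 < p → ∀ {a b} → v≥ b (p^ a) → b ≤ a
  v≥-p^⇒≤ 1<p {a} {b} (c , pᵃ≈) with pᵃ≈ b
  ... | q , e = ℕP.≮⇒≥ λ a<b → ℕP.<⇒≱ (ℕP.^-monoʳ-< p 1<p a<b) pᵇ≤pᵃ
    where
    pᵃ≡ : pw p a ≡ (q ℤ.+ seq c b) ℤ.* pw p b
    pᵃ≡ = ≡.trans (solve 3 (λ u v w → u := (u :- v :* w) :+ w :* v) ≡.refl (pw p a) (pw p b) (seq c b))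
         (≡.trans (≡.cong (ℤ._+ seq c b ℤ.* pw p b) e) (≡.sym (ℤP.*-distribʳ-+ (pw p b) q (seq c b))))
    pᵇ≤pᵃ : p ℕ.^ b ≤ p ℕ.^ a
    pᵇ≤pᵃ = ∣⇒≤ {{ℕP.m^n≢0 p a {{ℕ.>-nonZero (ℕP.<-trans (ℕ.s≤s ℕ.z≤n) 1<p)}}}}
      (divides ℤ.∣ q ℤ.+ seq c b ∣ (≡.trans (≡.cong ℤ.∣_∣ pᵃ≡) (ℤP.abs-* (q ℤ.+ seq c b) (pw p b))))

  v≥-transfer : .{{NonZero p}} → ∀ {a b k} {z x : ℤp p} →
                p^ a *p z ≋ p^ b *p x → b ≤ k + a → v≥ k z ⇔ v≥ (k + a ∸ b) x
  v≥-transfer {a} {b} {k} {z} {x} pᵃz≋pᵇx b≤k+a = mk⇔ to from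
    where
    open SetoidReasoning ≋-setoid
    shift : ∀ y → p^ (k + a) *p y ≋ p^ b *p (p^ (k + a ∸ b) *p y)
    shift y = ≋-sym (≋-trans (p^-*p^ b (k + a ∸ b) y) (*p-congʳ (p^-cong (ℕP.m∸n+n≡m b≤k+a)) y))
    to : v≥ k z → v≥ (k + a ∸ b) x
    to z-val@(y , _) = v≥-intro {k + a ∸ b} {x} y (p^-cancelˡ b {x} (begin
      p^ b *p x                      ≈⟨ pᵃz≋pᵇx ⟨
      p^ a *p z                      ≈⟨ *p-congˡ (p^ a) (v≥-elim {k} {z} z-val) ⟩
      p^ a *p (p^ k *p y)            ≈⟨ p^-*p^ a k y ⟩
      p^ (k + a) *p y                ≈⟨ shift y ⟩
      p^ b *p (p^ (k + a ∸ b) *p y)  ∎))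
    from : v≥ (k + a ∸ b) x → v≥ k z
    from x-val@(y , _) = v≥-intro {k} {z} y (p^-cancelˡ a {z} (begin
      p^ a *p z                      ≈⟨ pᵃz≋pᵇx ⟩
      p^ b *p x                      ≈⟨ *p-congˡ (p^ b) (v≥-elim {k + a ∸ b} {x} x-val) ⟩
      p^ b *p (p^ (k + a ∸ b) *p y)  ≈⟨ shift y ⟨
      p^ (k + a) *p y                ≈⟨ p^-*p^ a k y ⟨
      p^ a *p (p^ k *p y)            ∎))

  -- Rows of R_p and their span

  infix 4 _≐_
  _≐_ : Row {p} → Row → Set
  v ≐ w = ∀ m → v m ≋ w m

  ≐-sym : {v w : Row {p}} → v ≐ w → w ≐ v
  ≐-sym v≐w m = ≋-sym (v≐w m)

  ≐-trans : {u v w : Row {p}} → u ≐ v → v ≐ w → u ≐ w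
  ≐-trans u≐v v≐w m = ≋-trans (u≐v m) (v≐w m)

  ≐-mkRow : {a₀ a₁ a₂ a₃ b₀ b₁ b₂ b₃ : ℤp p} → a₀ ≋ b₀ → a₁ ≋ b₁ → a₂ ≋ b₂ → a₃ ≋ b₃ →
            mkRow a₀ a₁ a₂ a₃ ≐ mkRow b₀ b₁ b₂ b₃
  ≐-mkRow e₀ _  _  _  0F = e₀
  ≐-mkRow _  e₁ _  _  1F = e₁
  ≐-mkRow _  _  e₂ _  2F = e₂
  ≐-mkRow _  _  _  e₃ 3F = e₃

  ·-comm : (v w : Row {p}) → v · w ≐ w · v
  ·-comm v w 0F = ≋-pointwise λ n →
    solve 8 (λ a₁ a₂ a₃ a₄ b₁ b₂ b₃ b₄ → a₁ :* b₄ :+ a₂ :* b₃ :+ a₃ :* b₂ :+ a₄ :* b₁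
                                       := b₁ :* a₄ :+ b₂ :* a₃ :+ b₃ :* a₂ :+ b₄ :* a₁)
      ≡.refl (seq (v 0F) n) (seq (v 1F) n) (seq (v 2F) n) (seq (v 3F) n)
             (seq (w 0F) n) (seq (w 1F) n) (seq (w 2F) n) (seq (w 3F) n)
  ·-comm v w 1F = ≋-pointwise λ n →
    solve 6 (λ a₂ a₃ a₄ b₂ b₃ b₄ → a₂ :* b₄ :+ a₃ :* b₃ :+ a₄ :* b₂ := b₂ :* a₄ :+ b₃ :* a₃ :+ b₄ :* a₂)
      ≡.refl (seq (v 1F) n) (seq (v 2F) n) (seq (v 3F) n) (seq (w 1F) n) (seq (w 2F) n) (seq (w 3F) n)
  ·-comm v w 2F = ≋-pointwise λ n →
    solve 4 (λ a₃ a₄ b₃ b₄ → a₃ :* b₄ :+ a₄ :* b₃ := b₃ :* a₄ :+ b₄ :* a₃)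
      ≡.refl (seq (v 2F) n) (seq (v 3F) n) (seq (w 2F) n) (seq (w 3F) n)
  ·-comm v w 3F = ≋-pointwise λ n → ℤP.*-comm (seq (v 3F) n) (seq (w 3F) n)

  0ᵣ : Row {p}
  0ᵣ _ = 0p

  combination : Mat {p} → (Fin 4 → ℤp p) → Row
  combination M c m = sum4 λ q → c q *p M q m

  infix 4 _∈Span_
  _∈Span_ : Row {p} → Mat → Set
  w ∈Span M = Σ (Fin 4 → ℤp p) λ c → ∀ m → w m ≈ combination M c m

  ∈Span-intro : ∀ M w c → w ≐ combination M c → w ∈Span M
  ∈Span-intro M w c w≐ = c , λ m → ≋⇒≈ (w≐ m)

  ∈Span-elim : ∀ M w ((c , _) : w ∈Span M) → w ≐ combination M c
  ∈Span-elim M w (c , w≈) m = ≈⇒≋ (w≈ m)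

  ∈Span-resp : ∀ M v {w} → v ≐ w → w ∈Span M → v ∈Span M
  ∈Span-resp M v {w} v≐w w∈ = ∈Span-intro M v (proj₁ w∈) (≐-trans v≐w (∈Span-elim M w w∈))

  0ᵣ∈Span : ∀ M → 0ᵣ ∈Span M
  0ᵣ∈Span M = ∈Span-intro M 0ᵣ (λ _ → 0p) λ m → ≋-pointwise λ n →
    solve 4 (λ a b c d → 𝟎 := 𝟎 :* a :+ 𝟎 :* b :+ 𝟎 :* c :+ 𝟎 :* d)
      ≡.refl (seq (M 0F m) n) (seq (M 1F m) n) (seq (M 2F m) n) (seq (M 3F m) n)

  row∈Span : ∀ M i → M i ∈Span M
  row∈Span M 0F = ∈Span-intro M (M 0F) (vec4 1p 0p 0p 0p) λ m → ≋-pointwise λ n →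
    solve 4 (λ a b c d → a := 𝟏 :* a :+ 𝟎 :* b :+ 𝟎 :* c :+ 𝟎 :* d)
      ≡.refl (seq (M 0F m) n) (seq (M 1F m) n) (seq (M 2F m) n) (seq (M 3F m) n)
  row∈Span M 1F = ∈Span-intro M (M 1F) (vec4 0p 1p 0p 0p) λ m → ≋-pointwise λ n →
    solve 4 (λ a b c d → b := 𝟎 :* a :+ 𝟏 :* b :+ 𝟎 :* c :+ 𝟎 :* d)
      ≡.refl (seq (M 0F m) n) (seq (M 1F m) n) (seq (M 2F m) n) (seq (M 3F m) n)
  row∈Span M 2F = ∈Span-intro M (M 2F) (vec4 0p 0p 1p 0p) λ m → ≋-pointwise λ n →
    solve 4 (λ a b c d → c := 𝟎 :* a :+ 𝟎 :* b :+ 𝟏 :* c :+ 𝟎 :* d)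
      ≡.refl (seq (M 0F m) n) (seq (M 1F m) n) (seq (M 2F m) n) (seq (M 3F m) n)
  row∈Span M 3F = ∈Span-intro M (M 3F) (vec4 0p 0p 0p 1p) λ m → ≋-pointwise λ n →
    solve 4 (λ a b c d → d := 𝟎 :* a :+ 𝟎 :* b :+ 𝟎 :* c :+ 𝟏 :* d)
      ≡.refl (seq (M 0F m) n) (seq (M 1F m) n) (seq (M 2F m) n) (seq (M 3F m) n)

  ∈Span-·-comm : ∀ M i j → M j · M i ∈Span M → M i · M j ∈Span M
  ∈Span-·-comm M i j = ∈Span-resp M (M i · M j) (·-comm (M i) (M j))

module Matrix {p : ℕ} (1<p : 1 < p) (k l r : ℕ) (a₂₁ a₃₁ a₃₂ : ℤp p) where

  instance
    p-nonZero : NonZero p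
    p-nonZero = ℕ.>-nonZero (ℕP.<-trans ℕ.z<s 1<p)

  open SetoidReasoning (≋-setoid {p})

  -- The paper's rows v₁, …, v₄ are M 0F, …, M 3F.
  M : Mat {p}
  M = vec4 (mkRow (p^ k) 0p 0p 0p) (mkRow a₂₁ (p^ l) 0p 0p) (mkRow a₃₁ a₃₂ (p^ r) 0p) (mkRow 0p 0p 0p 1p)

  s : ℕ
  s = 2 * r ∸ l

  X Z : ℤp p
  X = ι (+ 2) *p p^ l *p a₃₂ -p p^ r *p a₂₁
  Z = ι (+ 2) *p p^ r *p a₃₂ -p p^ s *p a₂₁

  M-comb : (c₀ c₁ c₂ c₃ : ℤp p) → Row {p}
  M-comb c₀ c₁ c₂ c₃ = mkRow (p^ k *p c₀ +p a₂₁ *p c₁ +p a₃₁ *p c₂) (p^ l *p c₁ +p a₃₂ *p c₂) (p^ r *p c₂) c₃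

  combination≐M-comb : ∀ c₀ c₁ c₂ c₃ → combination M (vec4 c₀ c₁ c₂ c₃) ≐ M-comb c₀ c₁ c₂ c₃
  combination≐M-comb c₀ c₁ c₂ c₃ 0F = ≋-pointwise λ n →
    solve 7 (λ c₀ c₁ c₂ c₃ x a b → c₀ :* x :+ c₁ :* a :+ c₂ :* b :+ c₃ :* 𝟎 := x :* c₀ :+ a :* c₁ :+ b :* c₂)
      ≡.refl (seq c₀ n) (seq c₁ n) (seq c₂ n) (seq c₃ n) (pw p k) (seq a₂₁ n) (seq a₃₁ n)
  combination≐M-comb c₀ c₁ c₂ c₃ 1F = ≋-pointwise λ n →
    solve 6 (λ c₀ c₁ c₂ c₃ y a → c₀ :* 𝟎 :+ c₁ :* y :+ c₂ :* a :+ c₃ :* 𝟎 := y :* c₁ :+ a :* c₂)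
      ≡.refl (seq c₀ n) (seq c₁ n) (seq c₂ n) (seq c₃ n) (pw p l) (seq a₃₂ n)
  combination≐M-comb c₀ c₁ c₂ c₃ 2F = ≋-pointwise λ n →
    solve 5 (λ c₀ c₁ c₂ c₃ z → c₀ :* 𝟎 :+ c₁ :* 𝟎 :+ c₂ :* z :+ c₃ :* 𝟎 := z :* c₂)
      ≡.refl (seq c₀ n) (seq c₁ n) (seq c₂ n) (seq c₃ n) (pw p r)
  combination≐M-comb c₀ c₁ c₂ c₃ 3F = ≋-pointwise λ n →
    solve 4 (λ c₀ c₁ c₂ c₃ → c₀ :* 𝟎 :+ c₁ :* 𝟎 :+ c₂ :* 𝟎 :+ c₃ :* 𝟏 := c₃)
      ≡.refl (seq c₀ n) (seq c₁ n) (seq c₂ n) (seq c₃ n)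

  M-comb-∈Span : ∀ w c₀ c₁ c₂ c₃ → w ≐ M-comb c₀ c₁ c₂ c₃ → w ∈Span M
  M-comb-∈Span w c₀ c₁ c₂ c₃ w≐ =
    ∈Span-intro M w (vec4 c₀ c₁ c₂ c₃) (≐-trans w≐ (≐-sym (combination≐M-comb c₀ c₁ c₂ c₃)))

  ∈Span-M-comb : ∀ w ((c , _) : w ∈Span M) → w ≐ M-comb (c 0F) (c 1F) (c 2F) (c 3F)
  ∈Span-M-comb w w∈@(c , _) m = ≋-trans (∈Span-elim M w w∈ m) (≋-trans (≋-pointwise λ _ → ≡.refl)
    (combination≐M-comb (c 0F) (c 1F) (c 2F) (c 3F) m))

  v₄·≐ : ∀ j → M 3F · M j ≐ M j
  v₄·≐ j 0F = ≋-pointwise λ n →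
    solve 4 (λ b₁ b₂ b₃ b₄ → 𝟎 :* b₄ :+ 𝟎 :* b₃ :+ 𝟎 :* b₂ :+ 𝟏 :* b₁ := b₁)
      ≡.refl (seq (M j 0F) n) (seq (M j 1F) n) (seq (M j 2F) n) (seq (M j 3F) n)
  v₄·≐ j 1F = ≋-pointwise λ n →
    solve 3 (λ b₂ b₃ b₄ → 𝟎 :* b₄ :+ 𝟎 :* b₃ :+ 𝟏 :* b₂ := b₂) ≡.refl (seq (M j 1F) n) (seq (M j 2F) n) (seq (M j 3F) n)
  v₄·≐ j 2F = ≋-pointwise λ n → solve 2 (λ b₃ b₄ → 𝟎 :* b₄ :+ 𝟏 :* b₃ := b₃) ≡.refl (seq (M j 2F) n) (seq (M j 3F) n)
  v₄·≐ j 3F = ≋-pointwise λ n → ℤP.*-identityˡ (seq (M j 3F) n)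

  v₁·≐0 : ∀ j → M j 3F ≋ 0p → M 0F · M j ≐ 0ᵣ
  v₁·≐0 j b₄≋0 0F = begin
    (M 0F · M j) 0F
      ≈⟨ ≋-pointwise (λ n → solve 5 (λ x b₁ b₂ b₃ b₄ → x :* b₄ :+ 𝟎 :* b₃ :+ 𝟎 :* b₂ :+ 𝟎 :* b₁ := x :* b₄)
                                    ≡.refl (pw p k) (seq (M j 0F) n) (seq (M j 1F) n) (seq (M j 2F) n) (seq (M j 3F) n)) ⟩
    p^ k *p M j 3F        ≈⟨ *p-congˡ (p^ k) b₄≋0 ⟩
    p^ k *p 0p            ≈⟨ ≋-pointwise (λ _ → ℤP.*-zeroʳ (pw p k)) ⟩
    0p                    ∎
  v₁·≐0 j _ 1F = ≋-pointwise λ n →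
    solve 3 (λ b₂ b₃ b₄ → 𝟎 :* b₄ :+ 𝟎 :* b₃ :+ 𝟎 :* b₂ := 𝟎) ≡.refl (seq (M j 1F) n) (seq (M j 2F) n) (seq (M j 3F) n)
  v₁·≐0 j _ 2F = ≋-pointwise λ n → solve 2 (λ b₃ b₄ → 𝟎 :* b₄ :+ 𝟎 :* b₃ := 𝟎) ≡.refl (seq (M j 2F) n) (seq (M j 3F) n)
  v₁·≐0 j _ 3F = ≋-pointwise λ n → solve 1 (λ b₄ → 𝟎 :* b₄ := 𝟎) ≡.refl (seq (M j 3F) n)

  v₂·v₂≐0 : M 1F · M 1F ≐ 0ᵣ
  v₂·v₂≐0 0F = ≋-pointwise λ n → solve 2 (λ a y → a :* 𝟎 :+ y :* 𝟎 :+ 𝟎 :* y :+ 𝟎 :* a := 𝟎) ≡.refl (seq a₂₁ n) (pw p l)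
  v₂·v₂≐0 1F = ≋-pointwise λ n → solve 1 (λ y → y :* 𝟎 :+ 𝟎 :* 𝟎 :+ 𝟎 :* y := 𝟎) ≡.refl (pw p l)
  v₂·v₂≐0 2F = ≋-pointwise λ _ → ≡.refl
  v₂·v₂≐0 3F = ≋-pointwise λ _ → ≡.refl

  v₂·v₃≐ : M 1F · M 2F ≐ mkRow (p^ l *p p^ r) 0p 0p 0p
  v₂·v₃≐ 0F = ≋-pointwise λ n →
    solve 5 (λ a b c y z → a :* 𝟎 :+ y :* z :+ 𝟎 :* c :+ 𝟎 :* b := y :* z)
      ≡.refl (seq a₂₁ n) (seq a₃₁ n) (seq a₃₂ n) (pw p l) (pw p r)
  v₂·v₃≐ 1F = ≋-pointwise λ n →
    solve 3 (λ c y z → y :* 𝟎 :+ 𝟎 :* z :+ 𝟎 :* c := 𝟎) ≡.refl (seq a₃₂ n) (pw p l) (pw p r)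
  v₂·v₃≐ 2F = ≋-pointwise λ n → solve 1 (λ z → 𝟎 :* 𝟎 :+ 𝟎 :* z := 𝟎) ≡.refl (pw p r)
  v₂·v₃≐ 3F = ≋-pointwise λ _ → ≡.refl

  v₃·v₃≐ : M 2F · M 2F ≐ mkRow (ι (+ 2) *p p^ r *p a₃₂) (p^ r *p p^ r) 0p 0p
  v₃·v₃≐ 0F = ≋-pointwise λ n →
    solve 3 (λ b c z → b :* 𝟎 :+ c :* z :+ z :* c :+ 𝟎 :* b := con (+ 2) :* z :* c)
      ≡.refl (seq a₃₁ n) (seq a₃₂ n) (pw p r)
  v₃·v₃≐ 1F = ≋-pointwise λ n →
    solve 2 (λ c z → c :* 𝟎 :+ z :* z :+ 𝟎 :* c := z :* z) ≡.refl (seq a₃₂ n) (pw p r)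
  v₃·v₃≐ 2F = ≋-pointwise λ n → solve 1 (λ z → z :* 𝟎 :+ 𝟎 :* z := 𝟎) ≡.refl (pw p r)
  v₃·v₃≐ 3F = ≋-pointwise λ _ → ≡.refl

  M-comb-c₂≋0 : ∀ {e₀ e₁ e₃} c₀ c₁ c₂ c₃ → mkRow e₀ e₁ 0p e₃ ≐ M-comb c₀ c₁ c₂ c₃ → c₂ ≋ 0p
  M-comb-c₂≋0 _ _ c₂ _ e≐ = p^*x≋0⇒x≋0 r {c₂} (≋-sym (e≐ 2F))

  M-comb-t² : ∀ {e₀ e₁ e₃} c₀ c₁ c₂ c₃ → mkRow e₀ e₁ 0p e₃ ≐ M-comb c₀ c₁ c₂ c₃ → e₁ ≋ p^ l *p c₁
  M-comb-t² c₀ c₁ c₂ c₃ e≐ =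
    ≋-trans (e≐ 1F) (+p-*p-vanishes (p^ l *p c₁) a₃₂ c₂ (M-comb-c₂≋0 c₀ c₁ c₂ c₃ e≐))

  M-comb-t³ : ∀ {e₀ e₁ e₃} c₀ c₁ c₂ c₃ → mkRow e₀ e₁ 0p e₃ ≐ M-comb c₀ c₁ c₂ c₃ →
              e₀ ≋ p^ k *p c₀ +p a₂₁ *p c₁
  M-comb-t³ c₀ c₁ c₂ c₃ e≐ =
    ≋-trans (e≐ 0F) (+p-*p-vanishes (p^ k *p c₀ +p a₂₁ *p c₁) a₃₁ c₂ (M-comb-c₂≋0 c₀ c₁ c₂ c₃ e≐))

  v₂·v₃∈Span⇒ : M 1F · M 2F ∈Span M → k ≤ l + r
  v₂·v₃∈Span⇒ w∈@(c , _) = v≥-p^⇒≤ 1<p (v≥-intro {n = k} {x = p^ (l + r)} (c 0F) (begin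
    p^ (l + r)                   ≈⟨ p^-+ l r ⟩
    p^ l *p p^ r                 ≈⟨ M-comb-t³ (c 0F) (c 1F) (c 2F) (c 3F) w≐ ⟩
    p^ k *p c 0F +p a₂₁ *p c 1F  ≈⟨ +p-*p-vanishes (p^ k *p c 0F) a₂₁ (c 1F) c₁≋0 ⟩
    p^ k *p c 0F                 ∎))
    where
    w≐ : mkRow (p^ l *p p^ r) 0p 0p 0p ≐ M-comb (c 0F) (c 1F) (c 2F) (c 3F)
    w≐ = ≐-trans (≐-sym v₂·v₃≐) (∈Span-M-comb (M 1F · M 2F) w∈)
    c₁≋0 : c 1F ≋ 0p
    c₁≋0 = p^*x≋0⇒x≋0 l (≋-sym (M-comb-t² (c 0F) (c 1F) (c 2F) (c 3F) w≐))

  v₃·v₃∈Span⇒ : M 2F · M 2F ∈Span M → l ≤ 2 * r × v≥ k Z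
  v₃·v₃∈Span⇒ w∈@(c , _) = l≤2r , v≥-intro {n = k} {x = Z} (c 0F) (begin
    ι (+ 2) *p p^ r *p a₃₂ -p p^ s *p a₂₁
      ≈⟨ -p-congʳ {x = ι (+ 2) *p p^ r *p a₃₂} {x′ = p^ k *p c 0F +p a₂₁ *p c 1F}
                  (M-comb-t³ (c 0F) (c 1F) (c 2F) (c 3F) w≐) (p^ s *p a₂₁) ⟩
    p^ k *p c 0F +p a₂₁ *p c 1F -p p^ s *p a₂₁
      ≈⟨ -p-congʳ {x = p^ k *p c 0F +p a₂₁ *p c 1F} {x′ = p^ k *p c 0F +p a₂₁ *p p^ s}
                  (+p-congˡ (p^ k *p c 0F) (*p-congˡ a₂₁ c₁≋pˢ)) (p^ s *p a₂₁) ⟩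
    p^ k *p c 0F +p a₂₁ *p p^ s -p p^ s *p a₂₁
      ≈⟨ ≋-pointwise (λ n → solve 3 (λ x a y → x :+ a :* y ⊖ y :* a := x)
                                    ≡.refl (seq (p^ k *p c 0F) n) (seq a₂₁ n) (pw p s)) ⟩
    p^ k *p c 0F ∎)
    where
    w≐ : mkRow (ι (+ 2) *p p^ r *p a₃₂) (p^ r *p p^ r) 0p 0p ≐ M-comb (c 0F) (c 1F) (c 2F) (c 3F)
    w≐ = ≐-trans (≐-sym v₃·v₃≐) (∈Span-M-comb (M 2F · M 2F) w∈)
    p²ʳ≋pˡc₁ : p^ (2 * r) ≋ p^ l *p c 1F
    p²ʳ≋pˡc₁ = ≋-trans (p^-double r) (M-comb-t² (c 0F) (c 1F) (c 2F) (c 3F) w≐)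
    l≤2r : l ≤ 2 * r
    l≤2r = v≥-p^⇒≤ 1<p (v≥-intro {n = l} {x = p^ (2 * r)} (c 1F) p²ʳ≋pˡc₁)
    c₁≋pˢ : c 1F ≋ p^ s
    c₁≋pˢ = p^-cancelˡ l {x = c 1F} (≋-trans (≋-sym p²ʳ≋pˡc₁) (p^-split l≤2r))

  v₂·v₃∈Span : k ≤ l + r → M 1F · M 2F ∈Span M
  v₂·v₃∈Span k≤l+r = M-comb-∈Span (M 1F · M 2F) (p^ (l + r ∸ k)) 0p 0p 0p
    (≐-trans v₂·v₃≐ (≐-mkRow t³-column
      (≋-pointwise λ n → solve 2 (λ y c → 𝟎 := y :* 𝟎 :+ c :* 𝟎) ≡.refl (pw p l) (seq a₃₂ n))
      (≋-pointwise λ n → solve 1 (λ z → 𝟎 := z :* 𝟎) ≡.refl (pw p r))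
      ≋-refl))
    where
    t³-column : p^ l *p p^ r ≋ p^ k *p p^ (l + r ∸ k) +p a₂₁ *p 0p +p a₃₁ *p 0p
    t³-column = begin
      p^ l *p p^ r            ≈⟨ p^-+ l r ⟨
      p^ (l + r)              ≈⟨ p^-split k≤l+r ⟩
      p^ k *p p^ (l + r ∸ k)
        ≈⟨ ≋-pointwise (λ n → solve 3 (λ x a b → x := x :+ a :* 𝟎 :+ b :* 𝟎)
                                      ≡.refl (seq (p^ k *p p^ (l + r ∸ k)) n) (seq a₂₁ n) (seq a₃₁ n)) ⟩
      p^ k *p p^ (l + r ∸ k) +p a₂₁ *p 0p +p a₃₁ *p 0p ∎

  v₃·v₃∈Span : l ≤ 2 * r → v≥ k Z → M 2F · M 2F ∈Span M
  v₃·v₃∈Span l≤2r Z-val@(c₀ , _) = M-comb-∈Span (M 2F · M 2F) c₀ (p^ s) 0p 0p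
    (≐-trans v₃·v₃≐ (≐-mkRow t³-column t²-column
      (≋-pointwise λ n → solve 1 (λ z → 𝟎 := z :* 𝟎) ≡.refl (pw p r))
      ≋-refl))
    where
    t³-column : ι (+ 2) *p p^ r *p a₃₂ ≋ p^ k *p c₀ +p a₂₁ *p p^ s +p a₃₁ *p 0p
    t³-column = begin
      ι (+ 2) *p p^ r *p a₃₂
        ≈⟨ ≋-pointwise (λ n → solve 3 (λ u y a → u := u ⊖ y :* a :+ y :* a)
                                      ≡.refl (seq (ι (+ 2) *p p^ r *p a₃₂) n) (pw p s) (seq a₂₁ n)) ⟩
      Z +p p^ s *p a₂₁
        ≈⟨ +p-congʳ (v≥-elim {n = k} {x = Z} Z-val) (p^ s *p a₂₁) ⟩
      p^ k *p c₀ +p p^ s *p a₂₁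
        ≈⟨ ≋-pointwise (λ n → solve 4 (λ x y a b → x :+ y :* a := x :+ a :* y :+ b :* 𝟎)
                                      ≡.refl (seq (p^ k *p c₀) n) (pw p s) (seq a₂₁ n) (seq a₃₁ n)) ⟩
      p^ k *p c₀ +p a₂₁ *p p^ s +p a₃₁ *p 0p ∎
    t²-column : p^ r *p p^ r ≋ p^ l *p p^ s +p a₃₂ *p 0p
    t²-column = begin
      p^ r *p p^ r                 ≈⟨ p^-double r ⟨
      p^ (2 * r)                   ≈⟨ p^-split l≤2r ⟩
      p^ l *p p^ s                 ≈⟨ +p-*p-vanishes (p^ l *p p^ s) a₃₂ 0p ≋-refl ⟨
      p^ l *p p^ s +p a₃₂ *p 0p    ∎

  pˡZ≋pʳX : l ≤ 2 * r → p^ l *p Z ≋ p^ r *p X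
  pˡZ≋pʳX l≤2r = begin
    p^ l *p Z
      ≈⟨ ≋-pointwise (λ n →
           solve 5 (λ x z w a b → x :* (con (+ 2) :* z :* b ⊖ w :* a) := con (+ 2) :* (x :* z) :* b ⊖ (x :* w) :* a)
             ≡.refl (pw p l) (pw p r) (pw p s) (seq a₂₁ n) (seq a₃₂ n)) ⟩
    ι (+ 2) *p (p^ l *p p^ r) *p a₃₂ -p (p^ l *p p^ s) *p a₂₁
      ≈⟨ -p-congˡ (ι (+ 2) *p (p^ l *p p^ r) *p a₃₂) {y = (p^ l *p p^ s) *p a₂₁} {y′ = (p^ r *p p^ r) *p a₂₁}
                  (*p-congʳ pˡpˢ≋pʳpʳ a₂₁) ⟩
    ι (+ 2) *p (p^ l *p p^ r) *p a₃₂ -p (p^ r *p p^ r) *p a₂₁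
      ≈⟨ ≋-pointwise (λ n →
           solve 4 (λ x z a b → con (+ 2) :* (x :* z) :* b ⊖ (z :* z) :* a := z :* (con (+ 2) :* x :* b ⊖ z :* a))
             ≡.refl (pw p l) (pw p r) (seq a₂₁ n) (seq a₃₂ n)) ⟩
    p^ r *p X ∎
    where
    pˡpˢ≋pʳpʳ : p^ l *p p^ s ≋ p^ r *p p^ r
    pˡpˢ≋pʳpʳ = ≋-trans (≋-sym (p^-split l≤2r)) (p^-double r)

  Z⇔X : l ≤ 2 * r → v≥ k Z ⇔ v≥ (k + l ∸ r) X
  Z⇔X l≤2r with r ℕP.≤? k + l
  ... | yes r≤k+l = v≥-transfer {a = l} {b = r} {k = k} {z = Z} {x = X} (pˡZ≋pʳX l≤2r) r≤k+l
  ... | no r≰k+l = mk⇔ (λ _ → X-val) (λ _ → Z-val)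
    where
    k+l≤r : k + l ≤ r
    k+l≤r = ℕP.<⇒≤ (ℕP.≰⇒> r≰k+l)
    k≤r : k ≤ r
    k≤r = ℕP.≤-trans (ℕP.m≤m+n k l) k+l≤r
    k≤s : k ≤ s
    k≤s = ℕP.m+n≤o⇒m≤o∸n k (ℕP.≤-trans k+l≤r (ℕP.m≤m+n r (r + 0)))
    X-val : v≥ (k + l ∸ r) X
    X-val = ≡.subst (λ e → v≥ e X) {x = 0} {y = k + l ∸ r}
              (≡.sym (ℕP.m≤n⇒m∸n≡0 k+l≤r)) (v≥-zero X)
    Z-val : v≥ k Z
    Z-val = v≥-intro {n = k} {x = Z} (ι (+ 2) *p p^ (r ∸ k) *p a₃₂ -p p^ (s ∸ k) *p a₂₁) (begin
      ι (+ 2) *p p^ r *p a₃₂ -p p^ s *p a₂₁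
        ≈⟨ -p-cong {x = ι (+ 2) *p p^ r *p a₃₂} {x′ = ι (+ 2) *p (p^ k *p p^ (r ∸ k)) *p a₃₂}
                   {y = p^ s *p a₂₁} {y′ = (p^ k *p p^ (s ∸ k)) *p a₂₁}
                   (*p-congʳ (*p-congˡ (ι (+ 2)) (p^-split k≤r)) a₃₂) (*p-congʳ (p^-split k≤s) a₂₁) ⟩
      ι (+ 2) *p (p^ k *p p^ (r ∸ k)) *p a₃₂ -p (p^ k *p p^ (s ∸ k)) *p a₂₁
        ≈⟨ ≋-pointwise (λ n →
             solve 5 (λ x u v a b → con (+ 2) :* (x :* u) :* b ⊖ (x :* v) :* a := x :* (con (+ 2) :* u :* b ⊖ v :* a))
               ≡.refl (pw p k) (pw p (r ∸ k)) (pw p (s ∸ k)) (seq a₂₁ n) (seq a₃₂ n)) ⟩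
      p^ k *p (ι (+ 2) *p p^ (r ∸ k) *p a₃₂ -p p^ (s ∸ k) *p a₂₁) ∎)

  products∈Span : k ≤ l + r → l ≤ 2 * r → v≥ k Z → ∀ i j → M i · M j ∈Span M
  products∈Span _ _ _ 3F j = ∈Span-resp M (M 3F · M j) (v₄·≐ j) (row∈Span M j)
  products∈Span _ _ _ i 3F = ∈Span-·-comm M i 3F (∈Span-resp M (M 3F · M i) (v₄·≐ i) (row∈Span M i))
  products∈Span _ _ _ 0F 0F = ∈Span-resp M (M 0F · M 0F) (v₁·≐0 0F (≋-pointwise λ _ → ≡.refl)) (0ᵣ∈Span M)
  products∈Span _ _ _ 0F 1F = ∈Span-resp M (M 0F · M 1F) (v₁·≐0 1F (≋-pointwise λ _ → ≡.refl)) (0ᵣ∈Span M)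
  products∈Span _ _ _ 0F 2F = ∈Span-resp M (M 0F · M 2F) (v₁·≐0 2F (≋-pointwise λ _ → ≡.refl)) (0ᵣ∈Span M)
  products∈Span _ _ _ 1F 1F = ∈Span-resp M (M 1F · M 1F) v₂·v₂≐0 (0ᵣ∈Span M)
  products∈Span k≤l+r _ _ 1F 2F = v₂·v₃∈Span k≤l+r
  products∈Span _ l≤2r Z-val 2F 2F = v₃·v₃∈Span l≤2r Z-val
  products∈Span h₁ h₂ h₃ 1F 0F = ∈Span-·-comm M 1F 0F (products∈Span h₁ h₂ h₃ 0F 1F)
  products∈Span h₁ h₂ h₃ 2F 0F = ∈Span-·-comm M 2F 0F (products∈Span h₁ h₂ h₃ 0F 2F)
  products∈Span h₁ h₂ h₃ 2F 1F = ∈Span-·-comm M 2F 1F (products∈Span h₁ h₂ h₃ 1F 2F)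

  M-lowerTriangular : LowerTriangular M
  M-lowerTriangular 0F 1F _ = ≋⇒≈ (≋-refl {x = 0p})
  M-lowerTriangular 0F 2F _ = ≋⇒≈ (≋-refl {x = 0p})
  M-lowerTriangular 0F 3F _ = ≋⇒≈ (≋-refl {x = 0p})
  M-lowerTriangular 1F 2F _ = ≋⇒≈ (≋-refl {x = 0p})
  M-lowerTriangular 1F 3F _ = ≋⇒≈ (≋-refl {x = 0p})
  M-lowerTriangular 2F 3F _ = ≋⇒≈ (≋-refl {x = 0p})
  M-lowerTriangular _ 0F ()
  M-lowerTriangular (Fin.suc _) 1F (ℕ.s≤s ())
  M-lowerTriangular (Fin.suc (Fin.suc _)) 2F (ℕ.s≤s (ℕ.s≤s ()))
  M-lowerTriangular 3F 3F (ℕ.s≤s (ℕ.s≤s (ℕ.s≤s ())))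

  InM4-M⇔ : InM4 M ⇔ (l ≤ 2 * r × k ≤ l + r × v≥ (k + l ∸ r) X)
  InM4-M⇔ = mk⇔ forward backward
    where
    forward : InM4 M → l ≤ 2 * r × k ≤ l + r × v≥ (k + l ∸ r) X
    forward (_ , products) = l≤2r , v₂·v₃∈Span⇒ (products 1F 2F) , Equivalence.to (Z⇔X l≤2r) Z-val
      where
      l≤2r : l ≤ 2 * r
      l≤2r = proj₁ (v₃·v₃∈Span⇒ (products 2F 2F))
      Z-val : v≥ k Z
      Z-val = proj₂ (v₃·v₃∈Span⇒ (products 2F 2F))
    backward : l ≤ 2 * r × k ≤ l + r × v≥ (k + l ∸ r) X → InM4 M
    backward (l≤2r , k≤l+r , X-val) = M-lowerTriangular , products∈Span k≤l+r l≤2r Z-val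
      where
      Z-val : v≥ k Z
      Z-val = Equivalence.from (Z⇔X l≤2r) X-val

  -- Transporting along refl compares the two matrices at type Mat, where
  -- unfolding M is immediate, instead of comparing their products entrywise.
  InM4⇔ : InM4 (vec4 (mkRow (p^ k) 0p 0p 0p) (mkRow a₂₁ (p^ l) 0p 0p) (mkRow a₃₁ a₃₂ (p^ r) 0p) (mkRow 0p 0p 0p 1p))
          ⇔ (l ≤ 2 * r × k ≤ l + r × v≥ (k + l ∸ r) X)
  InM4⇔ = ≡.subst (λ (N : Mat {p}) → InM4 N ⇔ (l ≤ 2 * r × k ≤ l + r × v≥ (k + l ∸ r) X))
    {x = M} {y = vec4 (mkRow (p^ k) 0p 0p 0p) (mkRow a₂₁ (p^ l) 0p 0p) (mkRow a₃₁ a₃₂ (p^ r) 0p) (mkRow 0p 0p 0p 1p)}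
    ≡.refl InM4-M⇔

lemma5 : (p : ℕ) → Prime p → (k l r : ℕ) → (a21 a31 a32 : ℤp p) →
    InM4 {p} (vec4 (mkRow (p^ k) 0p 0p 0p)
                    (mkRow a21 (p^ l) 0p 0p)
                    (mkRow a31 a32 (p^ r) 0p)
                    (mkRow 0p 0p 0p 1p))
    ⇔ (l ≤ 2 * r × k ≤ l + r ×
       v≥ (k + l ∸ r) (ι (+ 2) *p p^ l *p a32 -p p^ r *p a21))
lemma5 p p-prime = Matrix.InM4⇔ (ℕ.nonTrivial⇒n>1 p {{prime⇒nonTrivial p-prime}})
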